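{- Let $\mathcal{F}=\langle E,H,\sim\rangle$ be an ETL frame in which $\sim$ is transitive and Euclidean and which has $\mathsf{PR_{hc}^\ell}$. If $h_1,h_2$ are histories with $h_1\preceq h_2$ and $h_1\sim h_2$, then for every $h_1'\preceq h_1$ there is $h_2'\preceq h_2$ such that $h_1'\sim h_2'$.
   Context: Fix a finite set $E$ of events; histories are finite sequences of events. Write $h\leadsto h'$ if $h'=he$ for some event $e$; $\preceq$ is the prefix relation (reflexive–transitive closure of $\leadsto$). A protocol $H$ is a finite prefix-closed set of histories. An ETL frame is $\langle E,H,\sim\rangle$ with $\sim\subseteq H\times H$. Euclidean: $h\sim h'$ and $h\sim h''$ imply $h'\sim h''$. $\mathsf{PR_{hc}^\ell}$: for all $h,h'$ and events $e$ with $he\sim h'$: (i) $h\sim h'$, or (ii) $h\sim h''\leadsto h'$ for some $h''$, or (iii) $he\sim h''\leadsto h'$ for some $h''$. -}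

module Defs where

open import Level using (Level; suc; _⊔_)
open import Data.Nat using (ℕ)
open import Data.Fin using (Fin)
open import Data.List using (List; _∷ʳ_; _++_)
open import Data.List.Membership.Propositional using (_∈_)
open import Data.Product using (Σ; ∃; ∃-syntax; _×_)
open import Data.Sum using (_⊎_)
open import Relation.Binary.PropositionalEquality using (_≡_)

-- Events: a finite set, represented as Fin n.
-- Histories: finite sequences of events (lists; events appended at the end).
History : ℕ → Set
History n = List (Fin n)

_⇝_ : {n : ℕ} → History n → History n → Set
h ⇝ h' = ∃[ e ] (h' ≡ h ∷ʳ e)

_≼_ : {n : ℕ} → History n → History n → Set
h ≼ h' = ∃[ k ] (h' ≡ h ++ k)

record ETLFrame (n : ℕ) : Set₁ where
  field
    H         : History n → Set
    finite    : ∃[ hs ] (∀ h → H h → h ∈ hs)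
    prefixClosed : ∀ {h h'} → h ≼ h' → H h' → H h
    _∼_       : History n → History n → Set
    ∼⊆H×H     : ∀ {h h'} → h ∼ h' → H h × H h'

module _ {n : ℕ} (F : ETLFrame n) where
  open ETLFrame F

  Transitive∼ : Set
  Transitive∼ = ∀ {h h' h''} → h ∼ h' → h' ∼ h'' → h ∼ h''

  Euclidean∼ : Set
  Euclidean∼ = ∀ {h h' h''} → h ∼ h' → h ∼ h'' → h' ∼ h''

  PR-hc-ℓ : Set
  PR-hc-ℓ = ∀ (h h' : History n) (e : Fin n) → (h ∷ʳ e) ∼ h' →
              (h ∼ h')
            ⊎ (∃[ h'' ] (h ∼ h'' × h'' ⇝ h'))
            ⊎ (∃[ h'' ] ((h ∷ʳ e) ∼ h'' × h'' ⇝ h'))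

-- If h e ∼ g, PR-hc-ℓ yields h ∼ g' for g' = g or g' ⇝ g, or else h e ∼ g' for
-- the one event shorter g' ⇝ g; recursing on g, a partner prefix of h exists.
-- Stripping the events of h₁ beyond h₁' one at a time proves the theorem.
module Submission where

open import Defs
open import Data.Nat using (ℕ)
open import Data.List using ([]; _∷_; _++_; _∷ʳ_)
open import Data.List.Properties using (++-assoc; ++-identityʳ; ∷ʳ-injectiveˡ)
open import Data.List.Reverse using (Reverse; []; _∶_∶ʳ_; reverseView)
open import Data.Product using (∃-syntax; _×_; _,_)
open import Data.Empty using (⊥-elim)
open import Data.Sum using (inj₁; inj₂)
open import Relation.Binary.PropositionalEquality using (_≡_; _≢_; refl; sym; subst)

module _ {n : ℕ} where

  []≢∷ʳ : ∀ (h : History n) {e} → [] ≢ h ∷ʳ e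
  []≢∷ʳ []      ()
  []≢∷ʳ (_ ∷ _) ()

  ≼-refl : (h : History n) → h ≼ h
  ≼-refl h = [] , sym (++-identityʳ h)

  ≼-trans : {a b c : History n} → a ≼ b → b ≼ c → a ≼ c
  ≼-trans {a} (k , refl) (l , refl) = k ++ l , ++-assoc a k l

  ⇝⇒≼ : {a b : History n} → a ⇝ b → a ≼ b
  ⇝⇒≼ (e , refl) = e ∷ [] , refl

  ≼-⇝ : {a b c : History n} → a ≼ b → b ⇝ c → a ≼ c
  ≼-⇝ p q = ≼-trans p (⇝⇒≼ q)

module _ {n : ℕ} (F : ETLFrame n) (pr : PR-hc-ℓ F) where
  open ETLFrame F

  ∷ʳ-∼⇒∼-prefix : ∀ h e {g} → Reverse g → (h ∷ʳ e) ∼ g → ∃[ g' ] (g' ≼ g × h ∼ g')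
  ∷ʳ-∼⇒∼-prefix h e {g} rg he∼g with pr h g e he∼g
  ... | inj₁ h∼g                      = g , ≼-refl g , h∼g
  ... | inj₂ (inj₁ (g' , h∼g' , g'⇝g)) = g' , ⇝⇒≼ g'⇝g , h∼g'
  ... | inj₂ (inj₂ (g' , he∼g' , (e' , g≡g'e'))) = shorter rg g≡g'e'
    where
    shorter : ∀ {g} → Reverse g → g ≡ g' ∷ʳ e' → ∃[ g'' ] (g'' ≼ g × h ∼ g'')
    shorter [] eq = ⊥-elim ([]≢∷ʳ g' eq)
    shorter (xs ∶ rxs ∶ʳ x) eq
      with g'' , g''≼xs , h∼g'' ← ∷ʳ-∼⇒∼-prefix h e rxs
             (subst ((h ∷ʳ e) ∼_) (sym (∷ʳ-injectiveˡ xs g' eq)) he∼g')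
      = g'' , ≼-⇝ g''≼xs (x , refl) , h∼g''

  ++-∼⇒∼-prefix : ∀ h k g → (h ++ k) ∼ g → ∃[ g' ] (g' ≼ g × h ∼ g')
  ++-∼⇒∼-prefix h [] g r = g , ≼-refl g , subst (_∼ g) (++-identityʳ h) r
  ++-∼⇒∼-prefix h (e ∷ k) g r
    with g₁ , g₁≼g , he∼g₁ ← ++-∼⇒∼-prefix (h ∷ʳ e) k g (subst (_∼ g) (sym (++-assoc h (e ∷ []) k)) r)
    with g₂ , g₂≼g₁ , h∼g₂ ← ∷ʳ-∼⇒∼-prefix h e (reverseView g₁) he∼g₁
    = g₂ , ≼-trans g₂≼g₁ g₁≼g , h∼g₂

mainTheorem10 : {n : ℕ} (F : ETLFrame n) → Transitive∼ F → Euclidean∼ F → PR-hc-ℓ F →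
    ∀ (h₁ h₂ : History n) → h₁ ≼ h₂ → ETLFrame._∼_ F h₁ h₂ →
    ∀ (h₁' : History n) → h₁' ≼ h₁ → ∃[ h₂' ] (h₂' ≼ h₂ × ETLFrame._∼_ F h₁' h₂')
mainTheorem10 F _ _ pr h₁ h₂ _ h₁∼h₂ h₁' (k , refl) = ++-∼⇒∼-prefix F pr h₁' k h₂ h₁∼h₂
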